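{- Let $G$ be a bipartite graph with bipartition $V_1,V_2$, where $|V_1|\ge 3$ and $|V_2|\ge 3$. Suppose that each $V_i$, $i\in\{1,2\}$, contains exactly two bipartite dominating vertices, and every vertex of $G$ that is not a bipartite dominating vertex has degree $2$. Then $G$ is $2$-$\gamma_{\rm MB}'$-critical.
   Context: In a bipartite graph with bipartition $V_1,V_2$, a vertex $x\in V_i$ is a bipartite dominating vertex if $x$ is adjacent to all vertices of the other part $V_{3-i}$. The Maker-Breaker domination (MBD) game on a graph $G$ is played by Dominator and Staller, who alternately select previously unselected vertices of $G$. Dominator wins if the set of vertices he has selected becomes a dominating set of $G$; Staller wins if she has selected at least one vertex of every dominating set of $G$. In the S-game Staller moves first. $\gamma_{\rm MB}'(G)$ is the minimum number $k$ such that Dominator has a strategy in the S-game guaranteeing that he wins having made at most $k$ moves, whatever Staller does; $\gamma_{\rm MB}'(G)=\infty$ if Dominator has no winning strategy in the S-game. A graph $G$ is $k$-$\gamma_{\rm MB}'$-critical if $\gamma_{\rm MB}'(G)=k$ and $\gamma_{\rm MB}'(G)<\gamma_{\rm MB}'(G-e)$ for every $e\in E(G)$. -}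

module Defs where

open import Data.Nat using (ℕ; zero; suc; _<_; _≤_)
open import Data.Bool using (Bool; true; false; _∧_; _∨_; not)
open import Data.Fin using (Fin; _≟_)
open import Data.Fin.Subset using (Subset; _∈_; _∉_; _∪_; ⁅_⁆; ⊥; ∣_∣)
open import Data.Vec using (tabulate)
open import Data.Product using (Σ; _×_; ∃)
open import Data.Sum using (_⊎_)
open import Relation.Nullary using (¬_)
open import Relation.Nullary.Decidable using (⌊_⌋)
open import Relation.Binary.PropositionalEquality using (_≡_; _≢_)
import Data.Bool as B

Adjacency : ℕ → Set
Adjacency n = Fin n → Fin n → Bool

IsSimpleGraph : {n : ℕ} → Adjacency n → Set
IsSimpleGraph {n} adj =
  (∀ (x y : Fin n) → adj x y ≡ adj y x) × (∀ (x : Fin n) → adj x x ≡ false)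

degree : {n : ℕ} → Adjacency n → Fin n → ℕ
degree adj x = ∣ tabulate (adj x) ∣

isPair : {n : ℕ} → Fin n → Fin n → Fin n → Fin n → Bool
isPair u v x y = (⌊ x ≟ u ⌋ ∧ ⌊ y ≟ v ⌋) ∨ (⌊ x ≟ v ⌋ ∧ ⌊ y ≟ u ⌋)

deleteEdge : {n : ℕ} → Adjacency n → Fin n → Fin n → Adjacency n
deleteEdge adj u v x y = adj x y ∧ not (isPair u v x y)

Dominating : {n : ℕ} → Adjacency n → Subset n → Set
Dominating {n} adj D = ∀ (x : Fin n) → x ∈ D ⊎ Σ (Fin n) (λ y → y ∈ D × adj x y ≡ true)

Free : {n : ℕ} → Subset n → Subset n → Fin n → Set
Free D S v = v ∉ D × v ∉ S

-- D = Dominator's vertices, S = Staller's.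
-- DomWinsS adj k D S : Staller is to move, and Dominator can force that his
--   set becomes dominating while making at most k further moves.
-- DomWinsD adj k D S : same, Dominator to move.
-- If D is not dominating and no vertex is free, every dominating set meets S,
-- i.e. Staller has won.
mutual
  DomWinsS : {n : ℕ} → Adjacency n → ℕ → Subset n → Subset n → Set
  DomWinsS {n} adj k D S =
    Dominating adj D ⊎
    (Σ (Fin n) (λ w → Free D S w) ×
     (∀ (v : Fin n) → Free D S v → DomWinsD adj k D (S ∪ ⁅ v ⁆)))

  DomWinsD : {n : ℕ} → Adjacency n → ℕ → Subset n → Subset n → Set
  DomWinsD adj zero D S = Dominating adj D
  DomWinsD {n} adj (suc k) D S =
    Dominating adj D ⊎
    Σ (Fin n) (λ v → Free D S v × DomWinsS adj k (D ∪ ⁅ v ⁆) S)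

SGameWin : {n : ℕ} → Adjacency n → ℕ → Set
SGameWin adj k = DomWinsS adj k ⊥ ⊥

GammaMB'≡ : {n : ℕ} → Adjacency n → ℕ → Set
GammaMB'≡ adj k = SGameWin adj k × (∀ (j : ℕ) → SGameWin adj j → k ≤ j)

-- k < γ'_MB(G)  (including the case γ'_MB(G) = ∞, where no j works)
GammaMB'> : {n : ℕ} → Adjacency n → ℕ → Set
GammaMB'> adj k = ∀ (j : ℕ) → SGameWin adj j → k < j

Critical : {n : ℕ} → ℕ → Adjacency n → Set
Critical {n} k adj =
  GammaMB'≡ adj k ×
  (∀ (u v : Fin n) → adj u v ≡ true → GammaMB'> (deleteEdge adj u v) k)

-- bipartition given by side : Fin n → Bool  (V₁ = side false, V₂ = side true)
IsBipartition : {n : ℕ} → Adjacency n → (Fin n → Bool) → Set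
IsBipartition {n} adj side = ∀ (x y : Fin n) → adj x y ≡ true → side x ≢ side y

part : {n : ℕ} → (Fin n → Bool) → Bool → Subset n
part side b = tabulate (λ x → ⌊ side x B.≟ b ⌋)

BipDominating : {n : ℕ} → Adjacency n → (Fin n → Bool) → Fin n → Set
BipDominating {n} adj side x = ∀ (y : Fin n) → side y ≢ side x → adj x y ≡ true

ExactlyTwoBipDom : {n : ℕ} → Adjacency n → (Fin n → Bool) → Bool → Set
ExactlyTwoBipDom {n} adj side b =
  Σ (Fin n) λ a → Σ (Fin n) λ c →
    a ≢ c × side a ≡ b × side c ≡ b ×
    BipDominating adj side a × BipDominating adj side c ×
    (∀ (z : Fin n) → side z ≡ b → BipDominating adj side z → z ≡ a ⊎ z ≡ c)

{-# OPTIONS --safe #-}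
-- A vertex that is not bipartite dominating has degree 2 and is adjacent to the
-- two bipartite dominating vertices of the other side, so it has no other
-- neighbour.  Hence, in G or in any spanning subgraph of G, a dominating pair
-- meets both sides, and if one of its vertices is bipartite dominating, so is
-- the other.
-- γ'(G) = 2: whatever Staller takes first, Dominator takes a bipartite dominating
-- vertex of the same side and threatens to finish with either of the two on the
-- other side.
-- γ'(G - uv) > 2 for u bipartite dominating: Staller opens with the twin u′ of u.
-- A reply that is not bipartite dominating she blocks with such a vertex of the
-- other side, a bipartite dominating reply on the side of v with u, and the reply
-- u with the twin of a bipartite dominating vertex r ≠ v of the side of v; then
-- r is the only partner left for u, but v has no neighbour in {u, r}.
module Submission where

open import Defs
open import Data.Nat using (ℕ; suc; _+_; _≤_; z≤n; s≤s; _≤?_)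
open import Data.Nat.Properties using (+-suc; n≤1+n; +-monoʳ-≤; ≤-trans; ≤-reflexive; ≰⇒>; <-irrefl; module ≤-Reasoning)
open import Data.Bool using (Bool; true; false; not; T; _∧_)
open import Data.Bool.Properties using (¬-not; not-¬; ∧-zeroʳ; ∨-zeroʳ) renaming (_≟_ to _≟ᵇ_)
open import Data.Fin using (Fin; _≟_)
open import Data.Fin.Properties using (any?)
open import Data.Fin.Subset using (Subset; _∈_; _∉_; _⊆_; _∪_; _-_; ⁅_⁆; ⊥; ∣_∣)
open import Data.Fin.Subset.Properties
  using (_∈?_; ∉⊥; x∈p∪q⁻; x∈p∪q⁺; x∈⁅x⁆; x∈⁅y⁆⇒x≡y; p⊆p∪q; p⊆q⇒∣p∣≤∣q∣; ∣⁅x⁆∣≡1; x∈p⇒∣p-x∣<∣p∣; x∈p∧x≢y⇒x∈p-y)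
open import Data.Vec using (_∷_; []; tabulate)
open import Data.Vec.Properties using (lookup∘tabulate; []=⇒lookup; lookup⇒[]=)
open import Data.Product using (∃₂; ∃-syntax; _×_; _,_; proj₁)
open import Data.Sum using (_⊎_; inj₁; inj₂; [_,_]′)
open import Relation.Nullary using (¬_; Dec; yes; no; ¬?; contradiction)
open import Relation.Nullary.Decidable using (⌊_⌋; _×-dec_; toWitness; decidable-stable; dec-true; isYes≗does)
open import Relation.Binary.PropositionalEquality using (_≡_; _≢_; refl; sym; trans; cong; cong₂; subst; ≢-sym)

private
  variable
    n j k : ℕ
    b : Bool
    p D S : Subset n
    A : Adjacency n
    s u v w x y z : Fin n

≢-≢⇒≡ : {a a′ c : Bool} → a ≢ c → a′ ≢ c → a ≡ a′
≢-≢⇒≡ a≢c a′≢c = trans (¬-not a≢c) (sym (¬-not a′≢c))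

∣p∪q∣≤∣p∣+∣q∣ : (p q : Subset n) → ∣ p ∪ q ∣ ≤ ∣ p ∣ + ∣ q ∣
∣p∪q∣≤∣p∣+∣q∣ [] [] = z≤n
∣p∪q∣≤∣p∣+∣q∣ (true ∷ p) (true ∷ q) = s≤s (≤-trans (∣p∪q∣≤∣p∣+∣q∣ p q) (+-monoʳ-≤ ∣ p ∣ (n≤1+n ∣ q ∣)))
∣p∪q∣≤∣p∣+∣q∣ (true ∷ p) (false ∷ q) = s≤s (∣p∪q∣≤∣p∣+∣q∣ p q)
∣p∪q∣≤∣p∣+∣q∣ (false ∷ p) (true ∷ q) = ≤-trans (s≤s (∣p∪q∣≤∣p∣+∣q∣ p q)) (≤-reflexive (sym (+-suc ∣ p ∣ ∣ q ∣)))
∣p∪q∣≤∣p∣+∣q∣ (false ∷ p) (false ∷ q) = ∣p∪q∣≤∣p∣+∣q∣ p q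

3≤∣p∣ : x ∈ p → y ∈ p → z ∈ p → x ≢ y → x ≢ z → y ≢ z → 3 ≤ ∣ p ∣
3≤∣p∣ {x = x} {p = p} {y} {z} x∈p y∈p z∈p x≢y x≢z y≢z = begin
  3                     ≤⟨ s≤s (s≤s (s≤s z≤n)) ⟩
  3 + ∣ p - x - y - z ∣  ≤⟨ s≤s (s≤s (x∈p⇒∣p-x∣<∣p∣ z∈p-x-y)) ⟩
  2 + ∣ p - x - y ∣      ≤⟨ s≤s (x∈p⇒∣p-x∣<∣p∣ y∈p-x) ⟩
  1 + ∣ p - x ∣          ≤⟨ x∈p⇒∣p-x∣<∣p∣ x∈p ⟩
  ∣ p ∣                  ∎
  where
  open ≤-Reasoning
  y∈p-x = x∈p∧x≢y⇒x∈p-y y∈p (≢-sym x≢y)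
  z∈p-x-y = x∈p∧x≢y⇒x∈p-y (x∈p∧x≢y⇒x∈p-y z∈p (≢-sym x≢z)) (≢-sym y≢z)

3≤∣p∣⇒∃-other-than : 3 ≤ ∣ p ∣ → (x y : Fin n) → ∃[ z ] z ∈ p × z ≢ x × z ≢ y
3≤∣p∣⇒∃-other-than {p = p} 3≤∣p∣ x y
  with any? (λ z → (z ∈? p) ×-dec (¬? (z ≟ x) ×-dec ¬? (z ≟ y)))
... | yes found = found
... | no none = contradiction (≤-trans 3≤∣p∣ ∣p∣≤2) (<-irrefl refl)
  where
  open ≤-Reasoning
  p⊆xy : p ⊆ ⁅ x ⁆ ∪ ⁅ y ⁆
  p⊆xy {z} z∈p with z ≟ x | z ≟ y
  ... | yes refl | _ = x∈p∪q⁺ (inj₁ (x∈⁅x⁆ z))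
  ... | no _ | yes refl = x∈p∪q⁺ (inj₂ (x∈⁅x⁆ z))
  ... | no z≢x | no z≢y = contradiction (z , z∈p , z≢x , z≢y) none
  ∣p∣≤2 : ∣ p ∣ ≤ 2
  ∣p∣≤2 = begin
    ∣ p ∣                  ≤⟨ p⊆q⇒∣p∣≤∣q∣ p⊆xy ⟩
    ∣ ⁅ x ⁆ ∪ ⁅ y ⁆ ∣       ≤⟨ ∣p∪q∣≤∣p∣+∣q∣ ⁅ x ⁆ ⁅ y ⁆ ⟩
    ∣ ⁅ x ⁆ ∣ + ∣ ⁅ y ⁆ ∣   ≡⟨ cong₂ _+_ (∣⁅x⁆∣≡1 x) (∣⁅x⁆∣≡1 y) ⟩
    2                      ∎

∈-tabulate⁺ : {f : Fin n → Bool} → f x ≡ true → x ∈ tabulate f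
∈-tabulate⁺ {x = x} {f} fx = lookup⇒[]= x (tabulate f) (trans (lookup∘tabulate f x) fx)

∈-tabulate⁻ : {f : Fin n → Bool} → x ∈ tabulate f → f x ≡ true
∈-tabulate⁻ {x = x} {f} x∈ = trans (sym (lookup∘tabulate f x)) ([]=⇒lookup x∈)

∈-part⁻ : {side : Fin n → Bool} → x ∈ part side b → side x ≡ b
∈-part⁻ {x = x} {b = b} {side} x∈ = toWitness {a? = side x ≟ᵇ b} (subst T (sym (∈-tabulate⁻ x∈)) _)

single : Fin n → Subset n
single x = ⊥ ∪ ⁅ x ⁆

pair : Fin n → Fin n → Subset n
pair x y = single x ∪ ⁅ y ⁆

∈single : x ∈ single x
∈single {x = x} = x∈p∪q⁺ (inj₂ (x∈⁅x⁆ x))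

∈single⁻ : y ∈ single x → y ≡ x
∈single⁻ {x = x} y∈ = [ (λ y∈⊥ → contradiction y∈⊥ ∉⊥) , x∈⁅y⁆⇒x≡y x ]′ (x∈p∪q⁻ ⊥ ⁅ x ⁆ y∈)

∉single : y ≢ x → y ∉ single x
∉single y≢x y∈ = y≢x (∈single⁻ y∈)

∉single⁻ : y ∉ single x → y ≢ x
∉single⁻ y∉ refl = y∉ ∈single

∈pairˡ : x ∈ pair x y
∈pairˡ = x∈p∪q⁺ (inj₁ ∈single)

∈pairʳ : y ∈ pair x y
∈pairʳ {y = y} = x∈p∪q⁺ (inj₂ (x∈⁅x⁆ y))

∈pair⁻ : z ∈ pair x y → z ≡ x ⊎ z ≡ y
∈pair⁻ {x = x} {y} z∈ = [ (λ z∈x → inj₁ (∈single⁻ z∈x)) , (λ z∈y → inj₂ (x∈⁅y⁆⇒x≡y y z∈y)) ]′ (x∈p∪q⁻ (single x) ⁅ y ⁆ z∈)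

∉pair : z ≢ x → z ≢ y → z ∉ pair x y
∉pair z≢x z≢y z∈ = [ z≢x , z≢y ]′ (∈pair⁻ z∈)

∉pair⁻ˡ : z ∉ pair x y → z ≢ x
∉pair⁻ˡ z∉ refl = z∉ ∈pairˡ

∉pair⁻ʳ : z ∉ pair x y → z ≢ y
∉pair⁻ʳ z∉ refl = z∉ ∈pairʳ

Dominating-mono : D ⊆ S → Dominating A D → Dominating A S
Dominating-mono D⊆S dom x with dom x
... | inj₁ x∈D = inj₁ (D⊆S x∈D)
... | inj₂ (y , y∈D , xy) = inj₂ (y , D⊆S y∈D , xy)

¬Dominating-⊥ : {A : Adjacency n} → Fin n → ¬ Dominating A ⊥
¬Dominating-⊥ x dom with dom x
... | inj₁ x∈⊥ = ∉⊥ x∈⊥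
... | inj₂ (_ , y∈⊥ , _) = ∉⊥ y∈⊥

undominated-pair : w ≢ x → w ≢ y → A w x ≡ false → A w y ≡ false → ¬ Dominating A (pair x y)
undominated-pair {w = w} w≢x w≢y ¬wx ¬wy dom with dom w
... | inj₁ w∈ = ∉pair w≢x w≢y w∈
... | inj₂ (d , d∈ , wd) with ∈pair⁻ d∈
...   | inj₁ refl = contradiction (trans (sym wd) ¬wx) λ ()
...   | inj₂ refl = contradiction (trans (sym wd) ¬wy) λ ()

mutual
  DomWinsS-mono : j ≤ k → DomWinsS A j D S → DomWinsS A k D S
  DomWinsS-mono j≤k (inj₁ dom) = inj₁ dom
  DomWinsS-mono j≤k (inj₂ (free , next)) = inj₂ (free , λ v v-free → DomWinsD-mono j≤k (next v v-free))

  DomWinsD-mono : j ≤ k → DomWinsD A j D S → DomWinsD A k D S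
  DomWinsD-mono {k = 0} z≤n dom = dom
  DomWinsD-mono {k = suc k} z≤n dom = inj₁ dom
  DomWinsD-mono (s≤s j≤k) (inj₁ dom) = inj₁ dom
  DomWinsD-mono (s≤s j≤k) (inj₂ (v , v-free , win)) = inj₂ (v , v-free , DomWinsS-mono j≤k win)

¬SGameWin⇒γ'> : ¬ SGameWin A k → GammaMB'> A k
¬SGameWin⇒γ'> {k = k} lose j win with j ≤? k
... | yes j≤k = contradiction (DomWinsS-mono j≤k win) lose
... | no j≰k = ≰⇒> j≰k

DomWinsS-0⇒Dominating : DomWinsS A 0 D S → Dominating A D
DomWinsS-0⇒Dominating (inj₁ dom) = dom
DomWinsS-0⇒Dominating (inj₂ ((v , v-free) , next)) = next v v-free

¬SGameWin-1 : ¬ Dominating A ⊥ → (∀ d → ¬ Dominating A (single d)) → ¬ SGameWin A 1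
¬SGameWin-1 ¬dom⊥ ¬dom₁ (inj₁ dom) = ¬dom⊥ dom
¬SGameWin-1 ¬dom⊥ ¬dom₁ (inj₂ ((s , s-free) , next)) with next s s-free
... | inj₁ dom = ¬dom⊥ dom
... | inj₂ (d , _ , win) = ¬dom₁ d (DomWinsS-0⇒Dominating win)

StallerAnswer : Adjacency n → Fin n → Fin n → Set
StallerAnswer {n} A s d =
  ∃[ s₂ ] s₂ ≢ d × s₂ ≢ s × (∀ (d₂ : Fin n) → d₂ ≢ s → d₂ ≢ s₂ → ¬ Dominating A (pair d d₂))

StallerStrategy : Adjacency n → Fin n → Set
StallerStrategy {n} A s = ∀ (d : Fin n) → d ≢ s → StallerAnswer A s d

¬SGameWin-2 : ¬ Dominating A ⊥ → (∀ d → ¬ Dominating A (single d)) → StallerStrategy A s → ¬ SGameWin A 2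
¬SGameWin-2 ¬dom⊥ ¬dom₁ strategy (inj₁ dom) = ¬dom⊥ dom
¬SGameWin-2 {s = s} ¬dom⊥ ¬dom₁ strategy (inj₂ (_ , next)) with next s (∉⊥ , ∉⊥)
... | inj₁ dom = ¬dom⊥ dom
... | inj₂ (d , _ , inj₁ dom) = ¬dom₁ d dom
... | inj₂ (d , (_ , d∉S) , inj₂ (_ , next′)) with strategy d (∉single⁻ d∉S)
...   | s₂ , s₂≢d , s₂≢s , blocked with next′ s₂ (∉single s₂≢d , ∉single s₂≢s)
...     | inj₁ dom = ¬dom₁ d dom
...     | inj₂ (d₂ , (_ , d₂∉S) , win) =
          blocked d₂ (∉pair⁻ˡ d₂∉S) (∉pair⁻ʳ d₂∉S) (DomWinsS-0⇒Dominating win)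

record DoubleThreat (A : Adjacency n) (s : Fin n) : Set where
  field
    d q q′ : Fin n
    d≢s : d ≢ s
    q≢q′ : q ≢ q′
    q≢s : q ≢ s
    q′≢s : q′ ≢ s
    q≢d : q ≢ d
    q′≢d : q′ ≢ d
    dominates : Dominating A (pair d q)
    dominates′ : Dominating A (pair d q′)

DoubleThreat⇒SGameWin-2 : {A : Adjacency n} → Fin n → (∀ s → DoubleThreat A s) → SGameWin A 2
DoubleThreat⇒SGameWin-2 {A = A} w threat = inj₂ ((w , ∉⊥ , ∉⊥) , λ s _ → answer s (threat s))
  where
  answer : ∀ s → DoubleThreat A s → DomWinsD A 2 ⊥ (single s)
  answer s threat-s = inj₂ (d , (∉⊥ , ∉single d≢s) , inj₂ ((q , ∉single q≢d , ∉single q≢s) , complete))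
    where
    open DoubleThreat threat-s
    complete : ∀ s₂ → Free (single d) (single s) s₂ → DomWinsD A 1 (single d) (pair s s₂)
    complete s₂ _ with s₂ ≟ q
    ... | yes refl = inj₂ (q′ , (∉single q′≢d , ∉pair q′≢s (≢-sym q≢q′)) , inj₁ dominates′)
    ... | no s₂≢q = inj₂ (q , (∉single q≢d , ∉pair q≢s (≢-sym s₂≢q)) , inj₁ dominates)

⌊x≟x⌋ : (x : Fin n) → ⌊ x ≟ x ⌋ ≡ true
⌊x≟x⌋ x = trans (isYes≗does (x ≟ x)) (dec-true (x ≟ x) refl)

deleteEdge-⊆ : (adj : Adjacency n) (u v : Fin n) → adj x y ≡ false → deleteEdge adj u v x y ≡ false
deleteEdge-⊆ {x = x} {y} adj u v ¬xy = cong (_∧ not (isPair u v x y)) ¬xy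

deleteEdge-removes : (adj : Adjacency n) (u v : Fin n) →
                     deleteEdge adj u v u v ≡ false × deleteEdge adj u v v u ≡ false
deleteEdge-removes adj u v rewrite ⌊x≟x⌋ u | ⌊x≟x⌋ v =
  ∧-zeroʳ (adj u v) , subst (λ t → adj v u ∧ not t ≡ false) (sym (∨-zeroʳ (⌊ v ≟ u ⌋ ∧ ⌊ u ≟ v ⌋))) (∧-zeroʳ (adj v u))

module BipartiteTwoCore {n : ℕ} {adj : Adjacency n} {side : Fin n → Bool}
                 (symmetric : ∀ x y → adj x y ≡ adj y x)
                 (bipartite : IsBipartition adj side)
                 (large : ∀ b → 3 ≤ ∣ part side b ∣)
                 (cores : ∀ b → ExactlyTwoBipDom adj side b)
                 (degree≡2 : ∀ x → ¬ BipDominating adj side x → degree adj x ≡ 2)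
                 where

  BD : Fin n → Set
  BD = BipDominating adj side

  record CorePair (b : Bool) (x y : Fin n) : Set where
    field
      distinct : x ≢ y
      sideˡ : side x ≡ b
      sideʳ : side y ≡ b
      BDˡ : BD x
      BDʳ : BD y
      only : ∀ z → side z ≡ b → BD z → z ≡ x ⊎ z ≡ y

  open CorePair

  corePair : ∀ b → ∃₂ (CorePair b)
  corePair b with cores b
  ... | x , y , x≢y , sx , sy , bdx , bdy , only = x , y , record
    { distinct = x≢y ; sideˡ = sx ; sideʳ = sy ; BDˡ = bdx ; BDʳ = bdy ; only = only }

  CorePair-sym : CorePair b x y → CorePair b y x
  CorePair-sym C = record
    { distinct = ≢-sym (distinct C) ; sideˡ = sideʳ C ; sideʳ = sideˡ C ; BDˡ = BDʳ C ; BDʳ = BDˡ C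
    ; only = λ z sz bdz → [ inj₂ , inj₁ ]′ (only C z sz bdz) }

  BD? : ∀ x → Dec (BD x)
  BD? x with corePair (side x)
  ... | a , c , C with x ≟ a | x ≟ c
  ... | yes refl | _ = yes (BDˡ C)
  ... | no _ | yes refl = yes (BDʳ C)
  ... | no x≢a | no x≢c = no λ bdx → [ x≢a , x≢c ]′ (only C x refl bdx)

  twin : BD u → ∃[ u′ ] CorePair (side u) u′ u
  twin {u} bdu with corePair (side u)
  ... | a , c , C with only C u refl bdu
  ... | inj₁ refl = c , CorePair-sym C
  ... | inj₂ refl = a , C

  BD-other-than : ∀ b v → ∃[ d ] side d ≡ b × BD d × d ≢ v
  BD-other-than b v with corePair b
  ... | a , c , C with a ≟ v
  ... | yes refl = c , sideʳ C , BDʳ C , ≢-sym (distinct C)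
  ... | no a≢v = a , sideˡ C , BDˡ C , a≢v

  vertex-other-than : ∀ b x y → ∃[ z ] side z ≡ b × z ≢ x × z ≢ y
  vertex-other-than b x y with 3≤∣p∣⇒∃-other-than {p = part side b} (large b) x y
  ... | z , z∈ , z≢x , z≢y = z , ∈-part⁻ {side = side} z∈ , z≢x , z≢y

  ¬BD-on : ∀ b → ∃[ z ] side z ≡ b × ¬ BD z
  ¬BD-on b with corePair b
  ... | a , c , C with vertex-other-than b a c
  ... | z , sz , z≢a , z≢c = z , sz , λ bdz → [ z≢a , z≢c ]′ (only C z sz bdz)

  side≢⇒≢ : side x ≢ side y → x ≢ y
  side≢⇒≢ sx≢sy refl = sx≢sy refl

  opposite⇒≢ : ∀ {b b′} → side x ≡ b → side y ≡ b′ → b ≢ b′ → x ≢ y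
  opposite⇒≢ sx sy b≢b′ = side≢⇒≢ λ e → b≢b′ (trans (sym sx) (trans e sy))

  BD-adjacent : BD x → side y ≢ side x → adj y x ≡ true
  BD-adjacent {x} {y} bdx sy≢sx = trans (symmetric y x) (bdx y sy≢sx)

  sameSide⇒¬adj : side x ≡ side y → adj x y ≡ false
  sameSide⇒¬adj {x} {y} sx≡sy with adj x y in xy
  ... | true = contradiction sx≡sy (bipartite x y xy)
  ... | false = refl

  ¬BD⇒¬adj : ¬ BD x → ¬ BD y → adj x y ≡ false
  ¬BD⇒¬adj {x} {y} ¬bdx ¬bdy with adj x y in xy
  ... | false = refl
  ... | true with corePair (side y)
  ...   | a , c , C = contradiction (subst (3 ≤_) (degree≡2 x ¬bdx) 3≤deg) (<-irrefl refl)
    where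
    x≁ : ∀ {z} → side z ≡ side y → side x ≢ side z
    x≁ sz sx≡sz = bipartite x y xy (trans sx≡sz sz)
    3≤deg : 3 ≤ degree adj x
    3≤deg = 3≤∣p∣ (∈-tabulate⁺ xy)
                  (∈-tabulate⁺ (BD-adjacent (BDˡ C) (x≁ (sideˡ C))))
                  (∈-tabulate⁺ (BD-adjacent (BDʳ C) (x≁ (sideʳ C))))
                  (λ { refl → ¬bdy (BDˡ C) }) (λ { refl → ¬bdy (BDʳ C) }) (distinct C)

  adjacent⇒BD⊎BD : adj x y ≡ true → BD x ⊎ BD y
  adjacent⇒BD⊎BD {x} {y} xy with BD? x | BD? y
  ... | yes bdx | _ = inj₁ bdx
  ... | no _ | yes bdy = inj₂ bdy
  ... | no ¬bdx | no ¬bdy = contradiction (trans (sym xy) (¬BD⇒¬adj ¬bdx ¬bdy)) λ ()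

  BD-pair-dominating : BD x → BD y → side x ≢ side y → Dominating adj (pair x y)
  BD-pair-dominating {x} {y} bdx bdy sx≢sy w with side w ≟ᵇ side x
  ... | yes sw≡sx = inj₂ (y , ∈pairʳ , BD-adjacent bdy λ sw≡sy → sx≢sy (trans (sym sw≡sx) sw≡sy))
  ... | no sw≢sx = inj₂ (x , ∈pairˡ , BD-adjacent bdx sw≢sx)

  doubleThreat : ∀ s → DoubleThreat adj s
  doubleThreat s with BD-other-than (side s) s | corePair (not (side s))
  ... | d , sd , bdd , d≢s | q , q′ , Q = record
    { d = d ; q = q ; q′ = q′ ; d≢s = d≢s ; q≢q′ = distinct Q
    ; q≢s = side≢⇒≢ q≁s ; q′≢s = side≢⇒≢ q′≁s
    ; q≢d = side≢⇒≢ (λ e → q≁s (trans e sd)) ; q′≢d = side≢⇒≢ (λ e → q′≁s (trans e sd))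
    ; dominates = BD-pair-dominating bdd (BDˡ Q) (λ e → q≁s (trans (sym e) sd))
    ; dominates′ = BD-pair-dominating bdd (BDʳ Q) (λ e → q′≁s (trans (sym e) sd)) }
    where
    q≁s : side q ≢ side s
    q≁s e = not-¬ e (sideˡ Q)
    q′≁s : side q′ ≢ side s
    q′≁s e = not-¬ e (sideʳ Q)

  module Subgraph {A : Adjacency n} (A⊆adj : ∀ {x y} → adj x y ≡ false → A x y ≡ false) where

    sameSide⇒¬dominating : side x ≡ side y → ¬ Dominating A (pair x y)
    sameSide⇒¬dominating {x} {y} sx≡sy with vertex-other-than (side x) x y
    ... | z , sz , z≢x , z≢y =
      undominated-pair z≢x z≢y (A⊆adj (sameSide⇒¬adj sz)) (A⊆adj (sameSide⇒¬adj (trans sz sx≡sy)))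

    ¬dominating-single : ∀ d → ¬ Dominating A (single d)
    ¬dominating-single d dom = sameSide⇒¬dominating refl (Dominating-mono (p⊆p∪q ⁅ d ⁆) dom)

    dominating-partner : BD x → Dominating A (pair x y) → BD y × side y ≢ side x
    dominating-partner {x} {y} bdx dom = decidable-stable (BD? y) ¬¬bdy , y≁x
      where
      y≁x : side y ≢ side x
      y≁x sy≡sx = sameSide⇒¬dominating (sym sy≡sx) dom
      ¬¬bdy : ¬ ¬ BD y
      ¬¬bdy ¬bdy with ¬BD-on (side x)
      ... | z , sz , ¬bdz = undominated-pair (λ { refl → ¬bdz bdx }) (λ { refl → y≁x sz })
                              (A⊆adj (sameSide⇒¬adj sz)) (A⊆adj (¬BD⇒¬adj ¬bdz ¬bdy)) dom

    ¬BD-answer : ∀ {s d} → BD s → ¬ BD d → StallerAnswer A s d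
    ¬BD-answer {s} {d} bds ¬bdd with ¬BD-on (not (side d))
    ... | z , sz , ¬bdz = z , z≢d , (λ { refl → ¬bdz bds }) , blocked
      where
      z≁d : side z ≢ side d
      z≁d e = not-¬ e sz
      z≢d : z ≢ d
      z≢d = side≢⇒≢ z≁d
      blocked : ∀ d₂ → d₂ ≢ s → d₂ ≢ z → ¬ Dominating A (pair d d₂)
      blocked d₂ _ d₂≢z with side d₂ ≟ᵇ side d
      ... | yes sd₂≡sd = sameSide⇒¬dominating (sym sd₂≡sd)
      ... | no sd₂≢sd = undominated-pair z≢d (≢-sym d₂≢z) (A⊆adj (¬BD⇒¬adj ¬bdz ¬bdd))
                                         (A⊆adj (sameSide⇒¬adj (≢-≢⇒≡ z≁d sd₂≢sd)))

    stallerStrategy : ∀ {b b′ s s′ r r′} → CorePair b s s′ → CorePair b′ r r′ → b′ ≢ b →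
                      ¬ Dominating A (pair s′ r) → StallerStrategy A s
    stallerStrategy {b} {b′} {s} {s′} {r} {r′} S R b′≢b ¬dom d d≢s with BD? d
    ... | no ¬bdd = ¬BD-answer (BDˡ S) ¬bdd
    ... | yes bdd with side d ≟ᵇ b
    ...   | no d∉b = s′ , opposite⇒≢ (sideʳ S) refl (≢-sym d∉b) , ≢-sym (distinct S) , blocked
      where
      blocked : ∀ d₂ → d₂ ≢ s → d₂ ≢ s′ → ¬ Dominating A (pair d d₂)
      blocked d₂ d₂≢s d₂≢s′ dom with dominating-partner bdd dom
      ... | bdd₂ , d₂≁d = [ d₂≢s , d₂≢s′ ]′ (only S d₂ (≢-≢⇒≡ d₂≁d (≢-sym d∉b)) bdd₂)
    ...   | yes d∈b with only S d d∈b bdd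
    ...     | inj₁ d≡s = contradiction d≡s d≢s
    ...     | inj₂ refl = r′ , opposite⇒≢ (sideʳ R) (sideʳ S) b′≢b , opposite⇒≢ (sideʳ R) (sideˡ S) b′≢b , blocked
      where
      blocked : ∀ d₂ → d₂ ≢ s → d₂ ≢ r′ → ¬ Dominating A (pair s′ d₂)
      blocked d₂ _ d₂≢r′ dom with dominating-partner bdd dom
      ... | bdd₂ , d₂≁s′ with only R d₂ (≢-≢⇒≡ (λ e → d₂≁s′ (trans e (sym (sideʳ S)))) b′≢b) bdd₂
      ...   | inj₁ refl = ¬dom dom
      ...   | inj₂ d₂≡r′ = d₂≢r′ d₂≡r′

    missingEdge⇒¬SGameWin-2 : BD u → side v ≢ side u → A v u ≡ false → ¬ SGameWin A 2
    missingEdge⇒¬SGameWin-2 {u} {v} bdu v≁u ¬vu with twin bdu | BD-other-than (side v) v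
    ... | u′ , U | r , sr , bdr , r≢v with twin bdr
    ...   | r′ , R =
      ¬SGameWin-2 (¬Dominating-⊥ u) ¬dominating-single
        (stallerStrategy U (CorePair-sym R) (λ e → v≁u (trans (sym sr) e)) ¬dom-ur)
      where
      ¬dom-ur : ¬ Dominating A (pair u r)
      ¬dom-ur = undominated-pair (side≢⇒≢ v≁u) (≢-sym r≢v) ¬vu (A⊆adj (sameSide⇒¬adj (sym sr)))

  vertex : Fin n
  vertex = proj₁ (corePair false)

  G-SGameWin-2 : SGameWin adj 2
  G-SGameWin-2 = DoubleThreat⇒SGameWin-2 vertex doubleThreat

  G-¬SGameWin-1 : ¬ SGameWin adj 1
  G-¬SGameWin-1 = ¬SGameWin-1 (¬Dominating-⊥ vertex) (Subgraph.¬dominating-single (λ ¬xy → ¬xy))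

  G-uv-¬SGameWin-2 : adj u v ≡ true → ¬ SGameWin (deleteEdge adj u v) 2
  G-uv-¬SGameWin-2 {u} {v} uv with adjacent⇒BD⊎BD uv | deleteEdge-removes adj u v
  ... | inj₁ bdu | _ , ¬vu =
    Subgraph.missingEdge⇒¬SGameWin-2 (deleteEdge-⊆ adj u v) bdu (λ e → bipartite u v uv (sym e)) ¬vu
  ... | inj₂ bdv | ¬uv , _ =
    Subgraph.missingEdge⇒¬SGameWin-2 (deleteEdge-⊆ adj u v) bdv (bipartite u v uv) ¬uv

lemma4p5 : (n : ℕ) (adj : Adjacency n) (side : Fin n → Bool) →
    IsSimpleGraph adj →
    IsBipartition adj side →
    3 ≤ ∣ part side Bool.false ∣ →
    3 ≤ ∣ part side Bool.true ∣ →
    (∀ (b : Bool) → ExactlyTwoBipDom adj side b) →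
    (∀ (x : Fin n) → ¬ BipDominating adj side x → degree adj x ≡ 2) →
    Critical 2 adj
lemma4p5 n adj side (symmetric , _) bipartite large₀ large₁ cores degree≡2 =
  (G-SGameWin-2 , ¬SGameWin⇒γ'> G-¬SGameWin-1) , λ u v uv → ¬SGameWin⇒γ'> (G-uv-¬SGameWin-2 uv)
  where
  large : ∀ b → 3 ≤ ∣ part side b ∣
  large false = large₀
  large true = large₁
  open BipartiteTwoCore symmetric bipartite large cores degree≡2
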